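{- Let $G$ be a finite loopless multigraph and $L\colon E(G)\to 2^{\mathbb{N}}$ a list assignment such that $\deg(x)+\mu(x)\le|f(x,L)|<\infty$ for every $x\in V(G)$. Let $\phi$ be a proper partial $L$-edge-coloring, $e$ an uncolored edge and $x\in V(e)$, and let $(F,\beta,j)$ be the output of the following procedure on $(\phi,e,x)$. Let $y$ be the other endpoint of $e$; set $B(z)\coloneqq A(\phi,z)$ for each neighbor $z$ of $x$ (mutable sets), $F\coloneqq(e_0)$ with $e_0\coloneqq e$, $y_0\coloneqq y$, $k\coloneqq 0$. Repeat: let $\eta\coloneqq\min B(y_k)$ and remove $\eta$ from $B(y_k)$; if $\eta\notin U(\phi,x)$, output $(F,\eta,k+1)$; otherwise set $k\coloneqq k+1$ and let $e_k$ be the edge at $x$ with $\phi(e_k)=\eta$; if $e_k=e_i$ for some edge $e_i$ already in $F$, output $(F,\eta,i)$; otherwise append $e_k$ to $F$, let $y_k$ be the endpoint of $e_k$ other than $x$, and repeat. Put $F'\coloneqq F|j$. Then at least one of the following holds: (1) $F$ is $\phi$-happy; (2) $F$ or $F'$ is $\phi$-content; (3) $A(G,\phi)=A(G,\psi)$ for $\psi\coloneqq\mathsf{Shift}(\phi,F)$, and there exist an edge $e'$ uncolored under $\psi$ with endpoints $u,v$ and colors $\alpha\in A(\psi,u)$, $\beta'\in A(\psi,v)$ such that $\mathsf{vStart}(P)\ne\mathsf{vEnd}(P)$ for $P=P(e';\psi,\alpha\beta')$; (4) $A(G,\phi)=A(G,\psi')$ for $\psi'\coloneqq\mathsf{Shift}(\phi,F')$,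 and there exist an edge $e'$ uncolored under $\psi'$ with endpoints $u,v$ and colors $\alpha\in A(\psi',u)$, $\beta'\in A(\psi',v)$ such that $\mathsf{vStart}(P)\ne\mathsf{vEnd}(P)$ for $P=P(e';\psi',\alpha\beta')$.
   Context: $E_G(x)$ is the set of edges at $x$, $\deg(x)=|E_G(x)|$, $V(e)$ the set of endpoints of $e$, $\mu(x,z)$ the number of edges between $x$ and $z$, $\mu(x)\coloneqq\max_z\mu(x,z)$, $f(x,L)\coloneqq\bigcap_{e\in E_G(x)}L(e)$. A partial $L$-edge-coloring is a map $\phi\colon E(G)\to\mathbb{N}\cup\{\mathsf{blank}\}$ with $\phi(e)\in L(e)\cup\{\mathsf{blank}\}$ ($\mathsf{blank}$ = uncolored; $U_\phi$ = set of uncolored edges); it is proper if distinct colored edges sharing an endpoint get distinct colors. Put $U(\phi,x)\coloneqq\{\phi(e): e\in E_G(x)\setminus U_\phi\}$ and $A(\phi,x)\coloneqq f(x,L)\setminus U(\phi,x)$. An uncolored edge $e$ with endpoints $x,y$ is $\phi$-happy if $A(\phi,x)\setminus U(\phi,y)\neq\emptyset$ or $A(\phi,y)\setminus U(\phi,x)\ne\emptyset$. A chain is a sequence $C=(e_0,\dots,e_{k-1})$ of distinct edges with $|V(e_i)\cap V(e_{i+1})|=1$ for $0\le i<k-1$; $\mathsf{End}(C)=e_{k-1}$, and $C|j\coloneqq(e_0,\dots,e_{j-1})$. $\mathsf{Shift}(\phi,C)$ is the coloring with $e_i\mapsto\phi(e_{i+1})$ for $0\le i<k-1$, $e_{k-1}\mapsto\mathsf{blank}$,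 all other edges unchanged. $C$ is $\phi$-shiftable if $\phi(e_0)=\mathsf{blank}$ and $\mathsf{Shift}(\phi,C)$ is a proper partial $L$-edge-coloring; $C$ is $\phi$-happy if it is $\phi$-shiftable and $\mathsf{End}(C)$ is $\mathsf{Shift}(\phi,C)$-happy. With $A(G,\phi)\coloneqq\sum_x|A(\phi,x)|$, $D(G,\phi)\coloneqq\sum_x\deg(x)\,|E_G(x)\cap U_\phi|$ and $\Phi(G,\phi)\coloneqq(A(G,\phi),D(G,\phi))$ ordered lexicographically, $C$ is $\phi$-content if it is $\phi$-shiftable and $\Phi(G,\mathsf{Shift}(\phi,C))<\Phi(G,\phi)$. For a coloring $\phi$, an uncolored edge $e$ with endpoints $x,y$ and colors $\alpha,\beta$, $P(e;\phi,\alpha\beta)=(e_0=e,e_1,\dots,e_{k-1})$ is the maximal chain such that there are distinct vertices $x_1=y,x_2,\dots,x_k$ with $e_i$ joining $x_i$ and $x_{i+1}$ for $1\le i\le k-1$, and $(\phi(e_1),\dots,\phi(e_{k-1}))$ alternates between $\alpha$ and $\beta$ starting with $\phi(e_1)=\alpha$; $\mathsf{vStart}(P)\coloneqq x$ and $\mathsf{vEnd}(P)\coloneqq x_k$ (so $\mathsf{vEnd}(P)=y$ if $k=1$). -}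

module Defs where

open import Data.Nat using (ℕ; zero; suc; _+_; _*_; _<_; _≤_; _⊔_; _≡ᵇ_)
open import Data.Bool using (Bool; true; false; if_then_else_; _∧_; _∨_; not)
open import Data.Fin using (Fin; toℕ) renaming (zero to fz; suc to fs)
import Data.Fin as Fin
open import Data.Maybe using (Maybe; just; nothing; is-nothing)
open import Data.List using (List; []; _∷_; _++_; length; lookup; take)
open import Data.List.Membership.Propositional using (_∉_)
open import Data.List.Relation.Unary.Unique.Propositional using (Unique)
open import Data.Product using (Σ; ∃; _×_; _,_)
open import Data.Sum using (_⊎_)
open import Data.Unit using (⊤)
open import Data.Empty using (⊥)
open import Relation.Nullary using (¬_)
open import Relation.Nullary.Decidable using (⌊_⌋)
open import Relation.Binary.PropositionalEquality using (_≡_; _≢_)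

countFin : ∀ {k} → (Fin k → Bool) → ℕ
countFin {zero}  p = 0
countFin {suc k} p = (if p fz then 1 else 0) + countFin (λ i → p (fs i))

sumFin : ∀ {k} → (Fin k → ℕ) → ℕ
sumFin {zero}  g = 0
sumFin {suc k} g = g fz + sumFin (λ i → g (fs i))

maxFin : ∀ {k} → (Fin k → ℕ) → ℕ
maxFin {zero}  g = 0
maxFin {suc k} g = g fz ⊔ maxFin (λ i → g (fs i))

anyFin : ∀ {k} → (Fin k → Bool) → Bool
anyFin {zero}  p = false
anyFin {suc k} p = p fz ∨ anyFin (λ i → p (fs i))

allFin : ∀ {k} → (Fin k → Bool) → Bool
allFin {zero}  p = true
allFin {suc k} p = p fz ∧ allFin (λ i → p (fs i))

cardBelow : ℕ → (ℕ → Bool) → ℕ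
cardBelow N p = countFin {N} (λ i → p (toℕ i))

_==F_ : ∀ {k} → Fin k → Fin k → Bool
a ==F b = ⌊ a Fin.≟ b ⌋

_==M_ : Maybe ℕ → Maybe ℕ → Bool
nothing ==M nothing = true
just a  ==M just b  = a ≡ᵇ b
_       ==M _       = false

record Multigraph : Set where
  field
    nV nE    : ℕ
    end₁     : Fin nE → Fin nV
    end₂     : Fin nE → Fin nV
    loopless : ∀ e → end₁ e ≢ end₂ e

open Multigraph public

Vtx : Multigraph → Set
Vtx G = Fin (nV G)

Edge : Multigraph → Set
Edge G = Fin (nE G)

Coloring : Multigraph → Set
Coloring G = Edge G → Maybe ℕ

ListAssignment : Multigraph → Set
ListAssignment G = Edge G → ℕ → Bool

module _ (G : Multigraph) where

  inc : Vtx G → Edge G → Bool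
  inc x e = (end₁ G e ==F x) ∨ (end₂ G e ==F x)

  Ends : Edge G → Vtx G → Vtx G → Set
  Ends e u v = (u ≡ end₁ G e × v ≡ end₂ G e) ⊎ (u ≡ end₂ G e × v ≡ end₁ G e)

  other : Vtx G → Edge G → Vtx G
  other x e = if end₁ G e ==F x then end₂ G e else end₁ G e

  deg : Vtx G → ℕ
  deg x = countFin (λ e → inc x e)

  mult : Vtx G → Vtx G → ℕ
  mult x z = countFin (λ e → inc x e ∧ inc z e ∧ not (x ==F z))

  μ : Vtx G → ℕ
  μ x = maxFin (λ z → mult x z)

  U : Coloring G → Vtx G → ℕ → Bool
  U φ x c = anyFin (λ e → inc x e ∧ (φ e ==M just c))

  SharedOne : Edge G → Edge G → Set
  SharedOne e e' = countFin (λ v → inc v e ∧ inc v e') ≡ 1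

  Consecutive : List (Edge G) → Set
  Consecutive []             = ⊤
  Consecutive (e ∷ [])       = ⊤
  Consecutive (e ∷ e' ∷ C)   = SharedOne e e' × Consecutive (e' ∷ C)

  IsChain : List (Edge G) → Set
  IsChain C = Unique C × Consecutive C

  endOf : List (Edge G) → Maybe (Edge G)
  endOf []           = nothing
  endOf (e ∷ [])     = just e
  endOf (e ∷ e' ∷ C) = endOf (e' ∷ C)

  Shift : Coloring G → List (Edge G) → Coloring G
  Shift φ []           = φ
  Shift φ (e ∷ [])     = λ d → if d ==F e then nothing else φ d
  Shift φ (e ∷ e' ∷ C) = λ d → if d ==F e then φ e' else Shift φ (e' ∷ C) d

  Dpot : Coloring G → ℕ
  Dpot φ = sumFin (λ x → deg x * countFin (λ e → inc x e ∧ is-nothing (φ e)))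

module _ (G : Multigraph) (L : ListAssignment G) where

  f : Vtx G → ℕ → Bool
  f x c = allFin (λ e → not (inc G x e) ∨ L e c)

  A : Coloring G → Vtx G → ℕ → Bool
  A φ x c = f x c ∧ not (U G φ x c)

  ProperPartial : Coloring G → Set
  ProperPartial φ =
    (∀ e c → φ e ≡ just c → L e c ≡ true) ×
    (∀ e e' c → e ≢ e' → (∃ λ v → inc G v e ≡ true × inc G v e' ≡ true) →
       φ e ≡ just c → φ e' ≡ just c → ⊥)

  EdgeHappy : Coloring G → Edge G → Set
  EdgeHappy φ e = φ e ≡ nothing ×
    ((∃ λ c → A φ (end₁ G e) c ≡ true × U G φ (end₂ G e) c ≡ false) ⊎
     (∃ λ c → A φ (end₂ G e) c ≡ true × U G φ (end₁ G e) c ≡ false))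

  Shiftable : Coloring G → List (Edge G) → Set
  Shiftable φ []      = ⊥
  Shiftable φ (e ∷ C) = IsChain G (e ∷ C) × φ e ≡ nothing × ProperPartial (Shift G φ (e ∷ C))

  HappyChain : Coloring G → List (Edge G) → Set
  HappyChain φ C = Shiftable φ C ×
    (∃ λ e → endOf G C ≡ just e × EdgeHappy (Shift G φ C) e)

  -- Walk ψ prev Es Vs cur c₁ c₂ w : the chain built so far has last edge
  -- prev, edge set Es, vertices x₁..x_i = Vs, current vertex cur = x_i;
  -- the next edge must have colour c₁ (then c₂, alternating); w is the
  -- final vertex vEnd of the maximal chain.

  CanExtend : Coloring G → Edge G → List (Edge G) → List (Vtx G) → Vtx G → ℕ → Edge G → Set
  CanExtend ψ prev Es Vs cur c d =
    inc G cur d ≡ true × ψ d ≡ just c × d ∉ Es × other G cur d ∉ Vs × SharedOne G prev d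

  data Walk (ψ : Coloring G) : Edge G → List (Edge G) → List (Vtx G) → Vtx G → ℕ → ℕ → Vtx G → Set where
    stop : ∀ {prev Es Vs cur c₁ c₂} →
           (∀ d → ¬ CanExtend ψ prev Es Vs cur c₁ d) →
           Walk ψ prev Es Vs cur c₁ c₂ cur
    step : ∀ {prev Es Vs cur c₁ c₂ w} d →
           CanExtend ψ prev Es Vs cur c₁ d →
           Walk ψ d (d ∷ Es) (other G cur d ∷ Vs) (other G cur d) c₂ c₁ w →
           Walk ψ prev Es Vs cur c₁ c₂ w

  -- vEnd(P(e'; ψ, αβ)) = w where e' has endpoints u (= vStart) and v
  PEnd : Coloring G → Edge G → Vtx G → ℕ → ℕ → Vtx G → Set
  PEnd ψ e' v α β w = Walk ψ e' (e' ∷ []) (v ∷ []) v α β w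

  -- The procedure of Lemma 4.1, as a relation on (state, output).
  -- State: the mutable sets B, the current F = (e₀,…,e_k), and y_k.

  IsMin : (ℕ → Bool) → ℕ → Set
  IsMin P η = P η ≡ true × (∀ c → c < η → P c ≡ false)

  removeB : (Vtx G → ℕ → Bool) → Vtx G → ℕ → Vtx G → ℕ → Bool
  removeB B y η z c = if (z ==F y) ∧ (c ≡ᵇ η) then false else B z c

  data Proc (φ : Coloring G) (x : Vtx G) :
       (Vtx G → ℕ → Bool) → List (Edge G) → Vtx G →
       List (Edge G) → ℕ → ℕ → Set where
    outNew : ∀ {B F yk} η → IsMin (B yk) η → U G φ x η ≡ false →
             Proc φ x B F yk F η (length F)
    outRep : ∀ {B F yk} η → IsMin (B yk) η → U G φ x η ≡ true →
             ∀ d → inc G x d ≡ true → φ d ≡ just η →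
             (i : Fin (length F)) → lookup F i ≡ d →
             Proc φ x B F yk F η (toℕ i)
    cont   : ∀ {B F yk F' β j} η → IsMin (B yk) η → U G φ x η ≡ true →
             ∀ d → inc G x d ≡ true → φ d ≡ just η → d ∉ F →
             Proc φ x (removeB B yk η) (F ++ (d ∷ [])) (other G x d) F' β j →
             Proc φ x B F yk F' β j

  Procedure : Coloring G → Edge G → Vtx G → List (Edge G) → ℕ → ℕ → Set
  Procedure φ e x F β j = Proc φ x (λ z → A φ z) (e ∷ []) (other G x e) F β j

  -- Potentials (colours counted below a bound N for the finite sets f(x,L))

  module _ (N : ℕ) where

    Apot : Coloring G → ℕ
    Apot φ = sumFin (λ x → cardBelow N (A φ x))

    LexLt : ℕ × ℕ → ℕ × ℕ → Set
    LexLt (a , d) (a' , d') = a < a' ⊎ (a ≡ a' × d < d')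

    Φ : Coloring G → ℕ × ℕ
    Φ φ = Apot φ , Dpot G φ

    Content : Coloring G → List (Edge G) → Set
    Content φ C = Shiftable φ C × LexLt (Φ (Shift G φ C)) (Φ φ)

    AltOutcome : Coloring G → List (Edge G) → Set
    AltOutcome φ C =
      Apot φ ≡ Apot (Shift G φ C) ×
      (∃ λ e' → ∃ λ u → ∃ λ v → ∃ λ α → ∃ λ β' →
         Shift G φ C e' ≡ nothing × Ends G e' u v ×
         A (Shift G φ C) u α ≡ true × A (Shift G φ C) v β' ≡ true ×
         (∃ λ w → PEnd (Shift G φ C) e' v α β' w × u ≢ w))

-- Throughout, F is a fan at x: its edges lie at x, and the colour of each edge lies in A(φ,·)
-- at the far end of its predecessor. Hence shifting φ along F, or along a prefix F', is proper
-- and consecutive edges share only x. Counting the colours of f(z,L) used at z as incidences of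
-- coloured edges shows that such a shift never increases A(G,·); if it decreases it, the chain
-- is content. If the procedure stops on a colour η unused at x, the last edge of F becomes happy.
-- Otherwise η = φ(e_i) with i ≥ 1. Pick α ∈ A(φ,x), which exists because e is uncoloured and
-- deg x ≤ |f(x,L)|, and follow the α/η path from y_k under ψ = Shift(φ,F). If it does not end at
-- x this is outcome (3). If it does, its last edge is e_{i-1}, which carries η after the shift;
-- reversed, it is P(e_{i-1}; ψ', αη) for ψ' = Shift(φ,F'), ending at y_k ≠ x since η stays
-- missing at y_k: outcome (4).

module Submission where

open import Defs
open import Data.Nat using (ℕ; zero; suc; _+_; _<_; _≤_; _≡ᵇ_; z≤n; s≤s)
import Data.Nat as ℕ
open import Data.Nat.Properties
open import Data.Nat.ListAction using (sum)
open import Data.Bool using (Bool; true; false; if_then_else_; _∧_; _∨_; not; T)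
import Data.Bool.Properties as Bool
open import Data.Bool.Properties using (∧-zeroʳ; ∧-identityʳ; ∧-comm; ∨-zeroʳ; ∧-distribʳ-∨; ∧-distribˡ-∨)
open import Data.Fin using (Fin; toℕ; fromℕ<) renaming (zero to fz; suc to fs)
import Data.Fin.Properties as Fin
open import Data.Maybe using (Maybe; just; nothing; maybe)
import Data.Maybe.Properties as Maybe
open import Data.Maybe.Properties using (just-injective)
open import Data.List using (List; []; _∷_; _++_; map; take; last; length; lookup)
open import Data.List.Membership.Propositional using (_∈_; _∉_)
open import Data.List.Membership.Propositional.Properties using (∈-++⁻; ∈-lookup)
import Data.List.Membership.DecPropositional as DecMembership
open import Data.List.Relation.Unary.Any using (here; there)
open import Data.List.Relation.Unary.All as All using ([])
open import Data.List.Relation.Unary.AllPairs using ([]; _∷_)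
open import Data.List.Relation.Unary.Unique.Propositional using (Unique)
open import Data.List.Relation.Unary.Unique.Propositional.Properties using (take⁺; ++⁺)
open import Data.Product using (∃; _×_; _,_; proj₁; proj₂)
open import Data.Sum using (_⊎_; inj₁; inj₂; [_,_]′)
open import Data.Unit using (tt)
open import Data.Empty using (⊥; ⊥-elim)
open import Function using (_∘_)
open import Relation.Nullary using (Dec; yes; no; does; ¬_; contradiction)
open import Relation.Nullary.Decidable using (_×-dec_; ¬?; dec-true; dec-false)
open import Relation.Binary.PropositionalEquality
open import Algebra.Properties.CommutativeSemigroup +-commutativeSemigroup
  using (interchange; x∙yz≈y∙xz; x∙yz≈yx∙z; xy∙z≈zy∙x)
open import Algebra.Properties.CommutativeMonoid.Sum +-0-commutativeMonoid
  using (sum-cong-≗; ∑-comm; ∑-distrib-+) renaming (sum to ∑)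

==F-refl : ∀ {k} (a : Fin k) → (a ==F a) ≡ true
==F-refl a with a Fin.≟ a
... | yes _ = refl
... | no a≢a = ⊥-elim (a≢a refl)

==F⇒≡ : ∀ {k} {a b : Fin k} → (a ==F b) ≡ true → a ≡ b
==F⇒≡ {a = a} {b} h with a Fin.≟ b
... | yes a≡b = a≡b

≢⇒==F-false : ∀ {k} {a b : Fin k} → a ≢ b → (a ==F b) ≡ false
≢⇒==F-false {a = a} {b} a≢b with a Fin.≟ b
... | yes a≡b = ⊥-elim (a≢b a≡b)
... | no _ = refl

≡ᵇ-refl : ∀ m → (m ≡ᵇ m) ≡ true
≡ᵇ-refl zero = refl
≡ᵇ-refl (suc m) = ≡ᵇ-refl m

≡ᵇ-true⇒≡ : ∀ {m n} → (m ≡ᵇ n) ≡ true → m ≡ n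
≡ᵇ-true⇒≡ {m} {n} h = ≡ᵇ⇒≡ m n (subst T (sym h) _)

==M-just⇒≡ : ∀ {m c} → (m ==M just c) ≡ true → m ≡ just c
==M-just⇒≡ {just a} h = cong just (≡ᵇ-true⇒≡ h)

≡⇒==M-just : ∀ {m c} → m ≡ just c → (m ==M just c) ≡ true
≡⇒==M-just {c = c} refl = ≡ᵇ-refl c

∧-true⁻ : ∀ {a b} → a ∧ b ≡ true → a ≡ true × b ≡ true
∧-true⁻ {true} {true} _ = refl , refl

∨-true⁻ : ∀ {a b} → a ∨ b ≡ true → a ≡ true ⊎ b ≡ true
∨-true⁻ {true} _ = inj₁ refl
∨-true⁻ {false} h = inj₂ h

anyFin-true⁻ : ∀ {k} {p : Fin k → Bool} → anyFin p ≡ true → ∃ λ i → p i ≡ true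
anyFin-true⁻ {suc k} {p} h with ∨-true⁻ {p fz} h
... | inj₁ p0 = fz , p0
... | inj₂ rest with anyFin-true⁻ rest
... | i , pi = fs i , pi

anyFin-true⁺ : ∀ {k} {p : Fin k → Bool} (i : Fin k) → p i ≡ true → anyFin p ≡ true
anyFin-true⁺ {suc k} {p} fz h rewrite h = refl
anyFin-true⁺ {suc k} {p} (fs i) h rewrite anyFin-true⁺ {p = λ j → p (fs j)} i h =
  ∨-zeroʳ (p fz)

allFin-true⁻ : ∀ {k} {p : Fin k → Bool} → allFin p ≡ true → ∀ i → p i ≡ true
allFin-true⁻ {suc k} {p} h fz = proj₁ (∧-true⁻ h)
allFin-true⁻ {suc k} {p} h (fs i) = allFin-true⁻ (proj₂ (∧-true⁻ {p fz} h)) i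

module _ {X : Set} where

  data Adjacent : List X → X → X → Set where
    ahere  : ∀ {a b C} → Adjacent (a ∷ b ∷ C) a b
    athere : ∀ {c a b C} → Adjacent C a b → Adjacent (c ∷ C) a b

  unique-head : ∀ {a : X} {C} → Unique (a ∷ C) → a ∉ C
  unique-head (a∉ ∷ _) m = All.lookup a∉ m refl

  unique-tail : ∀ {a : X} {C} → Unique (a ∷ C) → Unique C
  unique-tail (_ ∷ u) = u

  adjacent-∈ˡ : ∀ {C a b} → Adjacent C a b → a ∈ C
  adjacent-∈ˡ ahere = here refl
  adjacent-∈ˡ (athere h) = there (adjacent-∈ˡ h)

  adjacent-∈ʳ : ∀ {C a b} → Adjacent C a b → b ∈ C
  adjacent-∈ʳ ahere = there (here refl)
  adjacent-∈ʳ (athere h) = there (adjacent-∈ʳ h)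

  adjacent-∈-tail : ∀ {c C a b} → Adjacent (c ∷ C) a b → b ∈ C
  adjacent-∈-tail ahere = here refl
  adjacent-∈-tail (athere h) = adjacent-∈ʳ h

  adjacent-injective : ∀ {C a a' b} → Unique C → Adjacent C a b → Adjacent C a' b → a ≡ a'
  adjacent-injective u ahere ahere = refl
  adjacent-injective u ahere (athere h) = ⊥-elim (unique-head (unique-tail u) (adjacent-∈-tail h))
  adjacent-injective u (athere h) ahere = ⊥-elim (unique-head (unique-tail u) (adjacent-∈-tail h))
  adjacent-injective u (athere h) (athere h') = adjacent-injective (unique-tail u) h h'

  last-∈ : ∀ {C : List X} {a} → last C ≡ just a → a ∈ C
  last-∈ {e ∷ []} refl = here refl
  last-∈ {e ∷ e' ∷ C} h = there (last-∈ {e' ∷ C} h)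

  last-∷ : ∀ {c : X} {C a} → last C ≡ just a → last (c ∷ C) ≡ just a
  last-∷ {C = _ ∷ _} h = h

  last-∷ʳ : ∀ (C : List X) d → last (C ++ d ∷ []) ≡ just d
  last-∷ʳ [] d = refl
  last-∷ʳ (_ ∷ []) d = refl
  last-∷ʳ (_ ∷ e' ∷ C) d = last-∷ʳ (e' ∷ C) d

  last-¬adjacent : ∀ {C a b} → Unique C → last C ≡ just a → ¬ Adjacent C a b
  last-¬adjacent {e ∷ e' ∷ C} u h ahere = unique-head u (last-∈ {e' ∷ C} h)
  last-¬adjacent {e ∷ e' ∷ C} u h (athere adj) = last-¬adjacent (unique-tail u) h adj

  ∈⇒adjacent⊎last : ∀ {C : List X} {d} → d ∈ C → (∃ λ b → Adjacent C d b) ⊎ last C ≡ just d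
  ∈⇒adjacent⊎last {e ∷ []} (here refl) = inj₂ refl
  ∈⇒adjacent⊎last {e ∷ e' ∷ C} (here refl) = inj₁ (e' , ahere)
  ∈⇒adjacent⊎last {e ∷ e' ∷ C} (there m) with ∈⇒adjacent⊎last {e' ∷ C} m
  ... | inj₁ (b , h) = inj₁ (b , athere h)
  ... | inj₂ h = inj₂ h

  ∈-tail⇒predecessor : ∀ {e d : X} {R} → d ∈ R → ∃ λ a → Adjacent (e ∷ R) a d
  ∈-tail⇒predecessor {R = _ ∷ _} (here refl) = _ , ahere
  ∈-tail⇒predecessor {R = _ ∷ _} (there m) with ∈-tail⇒predecessor m
  ... | a , h = a , athere h

  adjacent-take⁻ : ∀ n {C a b} → Adjacent (take n C) a b → Adjacent C a b
  adjacent-take⁻ (suc (suc n)) {_ ∷ _ ∷ _} ahere = ahere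
  adjacent-take⁻ (suc n) {_ ∷ _} (athere h) = athere (adjacent-take⁻ n h)

  ∈-take⁻ : ∀ n {C : List X} {d} → d ∈ take n C → d ∈ C
  ∈-take⁻ (suc n) {c ∷ C} (here p) = here p
  ∈-take⁻ (suc n) {c ∷ C} (there m) = there (∈-take⁻ n m)

  adjacent-∷ʳ⁻ : ∀ {C a b d} → Adjacent (C ++ d ∷ []) a b → Adjacent C a b ⊎ (last C ≡ just a × b ≡ d)
  adjacent-∷ʳ⁻ {[]} (athere ())
  adjacent-∷ʳ⁻ {_ ∷ []} ahere = inj₂ (refl , refl)
  adjacent-∷ʳ⁻ {_ ∷ _ ∷ _} ahere = inj₁ ahere
  adjacent-∷ʳ⁻ {_ ∷ []} (athere (athere ()))
  adjacent-∷ʳ⁻ {_ ∷ e' ∷ C} (athere h) with adjacent-∷ʳ⁻ {e' ∷ C} h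
  ... | inj₁ h' = inj₁ (athere h')
  ... | inj₂ p = inj₂ p

  last-take-lookup : ∀ {F a b} (i : Fin (length F)) → Unique F → Adjacent F a b → lookup F i ≡ b →
    last (take (toℕ i) F) ≡ just a
  last-take-lookup {_ ∷ F} fz u h refl = ⊥-elim (unique-head u (adjacent-∈-tail h))
  last-take-lookup {_ ∷ _ ∷ F} (fs fz) u ahere _ = refl
  last-take-lookup {_ ∷ _ ∷ F} (fs (fs i)) u ahere refl = ⊥-elim (unique-head (unique-tail u) (∈-lookup i))
  last-take-lookup {c ∷ F} (fs i) u (athere h) e =
    last-∷ {c = c} {C = take (toℕ i) F} (last-take-lookup i (unique-tail u) h e)

cancel-≤ : ∀ {a b m n} → a + n ≡ b + m → m ≤ n → a ≤ b
cancel-≤ {a} {b} {m} {n} eq m≤n = +-cancelʳ-≤ n a b (≤-trans (≤-reflexive eq) (+-monoʳ-≤ b m≤n))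

𝟙 : Bool → ℕ
𝟙 b = if b then 1 else 0

sumFin≡∑ : ∀ {k} (g : Fin k → ℕ) → sumFin g ≡ ∑ g
sumFin≡∑ {zero} g = refl
sumFin≡∑ {suc k} g = cong (g fz +_) (sumFin≡∑ (λ i → g (fs i)))

countFin≡sumFin : ∀ {k} (p : Fin k → Bool) → countFin p ≡ sumFin (λ i → 𝟙 (p i))
countFin≡sumFin {zero} p = refl
countFin≡sumFin {suc k} p = cong (𝟙 (p fz) +_) (countFin≡sumFin (λ i → p (fs i)))

sumFin-cong : ∀ {k} {g h : Fin k → ℕ} → (∀ i → g i ≡ h i) → sumFin g ≡ sumFin h
sumFin-cong {zero} _ = refl
sumFin-cong {suc k} e = cong₂ _+_ (e fz) (sumFin-cong (λ i → e (fs i)))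

countFin-cong : ∀ {k} {p q : Fin k → Bool} → (∀ i → p i ≡ q i) → countFin p ≡ countFin q
countFin-cong {zero} _ = refl
countFin-cong {suc k} e = cong₂ _+_ (cong 𝟙 (e fz)) (countFin-cong (λ i → e (fs i)))

𝟙-mono : ∀ {a b} → (a ≡ true → b ≡ true) → 𝟙 a ≤ 𝟙 b
𝟙-mono {false} _ = z≤n
𝟙-mono {true} h rewrite h refl = ≤-refl

𝟙≤1 : ∀ b → 𝟙 b ≤ 1
𝟙≤1 true = ≤-refl
𝟙≤1 false = z≤n

countFin-mono : ∀ {k} {p q : Fin k → Bool} → (∀ i → p i ≡ true → q i ≡ true) → countFin p ≤ countFin q
countFin-mono {zero} _ = z≤n
countFin-mono {suc k} h = +-mono-≤ (𝟙-mono (h fz)) (countFin-mono (λ i → h (fs i)))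

countFin-mono-< : ∀ {k} {p q : Fin k → Bool} → (∀ i → p i ≡ true → q i ≡ true) →
  ∀ i → p i ≡ false → q i ≡ true → countFin p < countFin q
countFin-mono-< {suc k} h fz pi qi rewrite pi | qi = s≤s (countFin-mono (λ i → h (fs i)))
countFin-mono-< {suc k} h (fs i) pi qi = +-mono-≤-< (𝟙-mono (h fz)) (countFin-mono-< (λ i → h (fs i)) i pi qi)

countFin-false : ∀ {k} {p : Fin k → Bool} → (∀ i → p i ≡ false) → countFin p ≡ 0
countFin-false {zero} _ = refl
countFin-false {suc k} h rewrite h fz = countFin-false (λ i → h (fs i))

countFin-∧-false : ∀ {k} (p : Fin k → Bool) → countFin (λ i → p i ∧ false) ≡ 0
countFin-∧-false p = countFin-false (λ i → ∧-zeroʳ (p i))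

countFin-pos⇒∃ : ∀ {k} {p : Fin k → Bool} → 0 < countFin p → ∃ λ i → p i ≡ true
countFin-pos⇒∃ {suc k} {p} pos with p fz in p0
... | true = fz , p0
... | false with countFin-pos⇒∃ {p = λ i → p (fs i)} pos
... | i , pi = fs i , pi

countFin-at : ∀ {k} {p : Fin k → Bool} (u : Fin k) → (∀ i → p i ≡ true → i ≡ u) → countFin p ≡ 𝟙 (p u)
countFin-at {suc k} {p} fz only =
  trans (cong (𝟙 (p fz) +_) (countFin-false rest)) (+-identityʳ _)
  where
  rest : ∀ i → p (fs i) ≡ false
  rest i with p (fs i) in pi
  ... | true with () ← only (fs i) pi
  ... | false = refl
countFin-at {suc k} {p} (fs u) only with p fz in p0
... | true with () ← only fz p0
... | false = countFin-at u (λ i pi → Fin.suc-injective (only (fs i) pi))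

countFin-split : ∀ {k} (p q : Fin k → Bool) →
  countFin (λ i → p i ∧ q i) + countFin (λ i → p i ∧ not (q i)) ≡ countFin p
countFin-split {zero} p q = refl
countFin-split {suc k} p q =
  trans (interchange (𝟙 (p fz ∧ q fz)) _ (𝟙 (p fz ∧ not (q fz))) _)
        (cong₂ _+_ (split (p fz) (q fz)) (countFin-split (λ i → p (fs i)) (λ i → q (fs i))))
  where
  split : ∀ a b → 𝟙 (a ∧ b) + 𝟙 (a ∧ not b) ≡ 𝟙 a
  split false _ = refl
  split true false = refl
  split true true = refl

countFin-∨ : ∀ {k} (p q : Fin k → Bool) → (∀ i → p i ∧ q i ≡ false) →
  countFin (λ i → p i ∨ q i) ≡ countFin p + countFin q
countFin-∨ {zero} p q _ = refl
countFin-∨ {suc k} p q disjoint =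
  trans (cong₂ _+_ (𝟙-∨ (p fz) (q fz) (disjoint fz)) (countFin-∨ _ _ (λ i → disjoint (fs i))))
        (interchange (𝟙 (p fz)) (𝟙 (q fz)) _ _)
  where
  𝟙-∨ : ∀ a b → a ∧ b ≡ false → 𝟙 (a ∨ b) ≡ 𝟙 a + 𝟙 b
  𝟙-∨ false _ _ = refl
  𝟙-∨ true false _ = refl

sumFin-+ : ∀ {k} (g h : Fin k → ℕ) → sumFin (λ i → g i + h i) ≡ sumFin g + sumFin h
sumFin-+ g h = begin
  sumFin (λ i → g i + h i) ≡⟨ sumFin≡∑ (λ i → g i + h i) ⟩
  ∑ (λ i → g i + h i)      ≡⟨ ∑-distrib-+ g h ⟩
  ∑ g + ∑ h                ≡⟨ cong₂ _+_ (sumFin≡∑ g) (sumFin≡∑ h) ⟨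
  sumFin g + sumFin h      ∎
  where open ≡-Reasoning

sumFin-comm : ∀ {m n} (g : Fin m → Fin n → ℕ) →
  sumFin (λ i → sumFin (g i)) ≡ sumFin (λ j → sumFin (λ i → g i j))
sumFin-comm g = begin
  sumFin (λ i → sumFin (g i))          ≡⟨ sumFin≡∑ (λ i → sumFin (g i)) ⟩
  ∑ (λ i → sumFin (g i))               ≡⟨ sum-cong-≗ (λ i → sumFin≡∑ (g i)) ⟩
  ∑ (λ i → ∑ (g i))                    ≡⟨ ∑-comm g ⟩
  ∑ (λ j → ∑ (λ i → g i j))            ≡⟨ sum-cong-≗ (λ j → sumFin≡∑ (λ i → g i j)) ⟨
  ∑ (λ j → sumFin (λ i → g i j))       ≡⟨ sumFin≡∑ (λ j → sumFin (λ i → g i j)) ⟨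
  sumFin (λ j → sumFin (λ i → g i j))  ∎
  where open ≡-Reasoning

sumFin-exchange : ∀ {k} {g h : Fin k → ℕ} (a : Fin k) → (∀ i → i ≢ a → g i ≡ h i) →
  sumFin g + h a ≡ sumFin h + g a
sumFin-exchange {suc k} {g} {h} fz agree = begin
  (g fz + sg) + h fz ≡⟨ cong (λ s → (g fz + s) + h fz) (sumFin-cong (λ i → agree (fs i) λ ())) ⟩
  (g fz + sh) + h fz ≡⟨ xy∙z≈zy∙x (g fz) sh (h fz) ⟩
  (h fz + sh) + g fz ∎
  where
  open ≡-Reasoning
  sg = sumFin (λ i → g (fs i))
  sh = sumFin (λ i → h (fs i))
sumFin-exchange {suc k} {g} {h} (fs a) agree = begin
  (g fz + sg) + h (fs a) ≡⟨ +-assoc (g fz) sg _ ⟩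
  g fz + (sg + h (fs a)) ≡⟨ cong₂ _+_ (agree fz λ ()) (sumFin-exchange a λ i i≢a → agree (fs i) (i≢a ∘ Fin.suc-injective)) ⟩
  h fz + (sh + g (fs a)) ≡⟨ +-assoc (h fz) sh _ ⟨
  (h fz + sh) + g (fs a) ∎
  where
  open ≡-Reasoning
  sg = sumFin (λ i → g (fs i))
  sh = sumFin (λ i → h (fs i))

sum-map-cong : ∀ {k} {g h : Fin k → ℕ} (C : List (Fin k)) → (∀ {i} → i ∈ C → g i ≡ h i) →
  sum (map g C) ≡ sum (map h C)
sum-map-cong [] _ = refl
sum-map-cong (a ∷ C) e = cong₂ _+_ (e (here refl)) (sum-map-cong C (e ∘ there))

sumFin-exchange-list : ∀ {k} {g h : Fin k → ℕ} (F : List (Fin k)) → Unique F →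
  (∀ i → i ∉ F → g i ≡ h i) → sumFin g + sum (map h F) ≡ sumFin h + sum (map g F)
sumFin-exchange-list {g = g} {h} [] _ agree =
  cong (_+ 0) (sumFin-cong (λ i → agree i λ ()))
sumFin-exchange-list {g = g} {h} (a ∷ C) u agree = begin
  sumFin g + (h a + sum (map h C))     ≡⟨ x∙yz≈y∙xz (sumFin g) (h a) _ ⟩
  h a + (sumFin g + sum (map h C))     ≡⟨ cong (λ s → h a + (sumFin g + s)) (sum-map-cong C m≡h-on-C) ⟨
  h a + (sumFin g + sum (map m C))     ≡⟨ cong (h a +_) (sumFin-exchange-list C (unique-tail u) g≡m-off-C) ⟩
  h a + (sumFin m + sum (map g C))     ≡⟨ x∙yz≈yx∙z (h a) (sumFin m) _ ⟩
  (sumFin m + h a) + sum (map g C)     ≡⟨ cong (_+ sum (map g C)) (sumFin-exchange a m≡h-off-a) ⟩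
  (sumFin h + m a) + sum (map g C)     ≡⟨ cong (λ v → (sumFin h + v) + sum (map g C)) m-at-a ⟩
  (sumFin h + g a) + sum (map g C)     ≡⟨ +-assoc (sumFin h) (g a) _ ⟩
  sumFin h + (g a + sum (map g C))     ∎
  where
  open ≡-Reasoning
  m : Fin _ → ℕ
  m i = if i ==F a then g a else h i
  m-at-a : m a ≡ g a
  m-at-a rewrite ==F-refl a = refl
  m≡h-off-a : ∀ i → i ≢ a → m i ≡ h i
  m≡h-off-a i i≢a rewrite ≢⇒==F-false i≢a = refl
  m≡h-on-C : ∀ {i} → i ∈ C → m i ≡ h i
  m≡h-on-C {i} i∈C = m≡h-off-a i (λ i≡a → unique-head u (subst (_∈ C) i≡a i∈C))
  g≡m-off-C : ∀ i → i ∉ C → g i ≡ m i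
  g≡m-off-C i i∉C with i Fin.≟ a
  ... | yes refl = refl
  ... | no i≢a = agree i λ { (here i≡a) → i≢a i≡a ; (there i∈C) → i∉C i∈C }

cardBelow-single : ∀ N (P : ℕ → Bool) c₀ → (P c₀ ≡ true → c₀ < N) →
  cardBelow N (λ c → P c ∧ (c₀ ≡ᵇ c)) ≡ 𝟙 (P c₀)
cardBelow-single N P c₀ bounded with P c₀ in Pc₀
... | false = countFin-false none
  where
  none : ∀ (i : Fin N) → P (toℕ i) ∧ (c₀ ≡ᵇ toℕ i) ≡ false
  none i with c₀ ≡ᵇ toℕ i in e
  ... | false = ∧-zeroʳ (P (toℕ i))
  ... | true = trans (cong (λ c → P c ∧ true) (sym (≡ᵇ-true⇒≡ e))) (trans (∧-identityʳ (P c₀)) Pc₀)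
... | true = trans (countFin-at u only) (cong 𝟙 at-u)
  where
  c₀<N = bounded refl
  u = fromℕ< c₀<N
  only : ∀ i → P (toℕ i) ∧ (c₀ ≡ᵇ toℕ i) ≡ true → i ≡ u
  only i h = Fin.toℕ-injective (trans (sym (≡ᵇ-true⇒≡ (proj₂ (∧-true⁻ h)))) (sym (Fin.toℕ-fromℕ< c₀<N)))
  at-u : P (toℕ u) ∧ (c₀ ≡ᵇ toℕ u) ≡ true
  at-u rewrite Fin.toℕ-fromℕ< c₀<N | Pc₀ = ≡ᵇ-refl c₀

-- Double counting: g restricted to the indices selected by q is a bijection onto the colours it uses.
cardBelow-colours : ∀ N (P : ℕ → Bool) → (∀ c → P c ≡ true → c < N) →
  ∀ {k} (q : Fin k → Bool) (g : Fin k → Maybe ℕ) →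
  (∀ {i i' c} → q i ≡ true → q i' ≡ true → g i ≡ just c → g i' ≡ just c → i ≡ i') →
  cardBelow N (λ c → P c ∧ anyFin (λ i → q i ∧ (g i ==M just c)))
    ≡ countFin (λ i → q i ∧ maybe P false (g i))
cardBelow-colours N P bounded {zero} q g inj = countFin-∧-false {N} (λ c → P (toℕ c))
cardBelow-colours N P bounded {suc k} q g inj =
  trans (countFin-cong (λ c → ∧-distribˡ-∨ (P (toℕ c)) (at-0 c) (at-suc c)))
  (trans (countFin-∨ (λ c → P (toℕ c) ∧ at-0 c) (λ c → P (toℕ c) ∧ at-suc c) disjoint)
  (cong₂ _+_ (first (q fz) (g fz))
             (cardBelow-colours N P bounded (q ∘ fs) (g ∘ fs) λ qi qi' gi gi' → Fin.suc-injective (inj qi qi' gi gi'))))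
  where
  at-0 at-suc : Fin N → Bool
  at-0 c = q fz ∧ (g fz ==M just (toℕ c))
  at-suc c = anyFin (λ i → q (fs i) ∧ (g (fs i) ==M just (toℕ c)))
  first : ∀ b m → cardBelow N (λ c → P c ∧ (b ∧ (m ==M just c))) ≡ 𝟙 (b ∧ maybe P false m)
  first false m = countFin-∧-false {N} (λ c → P (toℕ c))
  first true nothing = countFin-∧-false {N} (λ c → P (toℕ c))
  first true (just c₀) = cardBelow-single N P c₀ (bounded c₀)
  disjoint : ∀ c → (P (toℕ c) ∧ at-0 c) ∧ (P (toℕ c) ∧ at-suc c) ≡ false
  disjoint c with at-0 c in at-0-c | at-suc c in at-suc-c
  ... | false | _ rewrite ∧-zeroʳ (P (toℕ c)) = refl
  ... | true | false rewrite ∧-zeroʳ (P (toℕ c)) = ∧-zeroʳ _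
  ... | true | true with anyFin-true⁻ {p = λ i → q (fs i) ∧ (g (fs i) ==M just (toℕ c))} at-suc-c
  ... | i , r with ∧-true⁻ {q fz} at-0-c | ∧-true⁻ {q (fs i)} r
  ... | q₀ , g₀ | qi , gi with () ← inj q₀ qi (==M-just⇒≡ g₀) (==M-just⇒≡ gi)

module Incidence (G : Multigraph) where

  inc⇒endpoint : ∀ {z d} → inc G z d ≡ true → end₁ G d ≡ z ⊎ end₂ G d ≡ z
  inc⇒endpoint {z} {d} h with ∨-true⁻ {end₁ G d ==F z} h
  ... | inj₁ p = inj₁ (==F⇒≡ p)
  ... | inj₂ p = inj₂ (==F⇒≡ p)

  endpoint⇒inc : ∀ {z d} → end₁ G d ≡ z ⊎ end₂ G d ≡ z → inc G z d ≡ true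
  endpoint⇒inc {d = d} (inj₁ refl) rewrite ==F-refl (end₁ G d) = refl
  endpoint⇒inc {d = d} (inj₂ refl) rewrite ==F-refl (end₂ G d) = ∨-zeroʳ (end₁ G d ==F end₂ G d)

  other-endpoints : ∀ {z d} → inc G z d ≡ true →
    (end₁ G d ≡ z × other G z d ≡ end₂ G d) ⊎ (end₂ G d ≡ z × other G z d ≡ end₁ G d)
  other-endpoints {z} {d} h with end₁ G d Fin.≟ z | inc⇒endpoint h
  ... | yes e₁≡z | _ = inj₁ (e₁≡z , refl)
  ... | no e₁≢z | inj₁ e₁≡z = ⊥-elim (e₁≢z e₁≡z)
  ... | no _ | inj₂ e₂≡z = inj₂ (e₂≡z , refl)

  ends-other : ∀ {z d} → inc G z d ≡ true → Ends G d z (other G z d)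
  ends-other h with other-endpoints h
  ... | inj₁ (p , q) = inj₁ (sym p , q)
  ... | inj₂ (p , q) = inj₂ (sym p , q)

  inc-other : ∀ {z d} → inc G z d ≡ true → inc G (other G z d) d ≡ true
  inc-other h with other-endpoints h
  ... | inj₁ (_ , q) = endpoint⇒inc (inj₂ (sym q))
  ... | inj₂ (_ , q) = endpoint⇒inc (inj₁ (sym q))

  other-≢ : ∀ {z d} → inc G z d ≡ true → other G z d ≢ z
  other-≢ {d = d} h with other-endpoints h
  ... | inj₁ (p , q) = λ r → loopless G d (trans p (sym (trans (sym q) r)))
  ... | inj₂ (p , q) = λ r → loopless G d (trans (trans (sym q) r) (sym p))

  inc⇒≡⊎≡other : ∀ {z v d} → inc G z d ≡ true → inc G v d ≡ true → v ≡ z ⊎ v ≡ other G z d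
  inc⇒≡⊎≡other h h' with other-endpoints h | inc⇒endpoint h'
  ... | inj₁ (p , q) | inj₁ r = inj₁ (trans (sym r) p)
  ... | inj₁ (p , q) | inj₂ r = inj₂ (trans (sym r) (sym q))
  ... | inj₂ (p , q) | inj₁ r = inj₂ (trans (sym r) (sym q))
  ... | inj₂ (p , q) | inj₂ r = inj₁ (trans (sym r) p)

  other-involutive : ∀ {z d} → inc G z d ≡ true → other G (other G z d) d ≡ z
  other-involutive h with inc⇒≡⊎≡other (inc-other h) h
  ... | inj₁ p = ⊥-elim (other-≢ h (sym p))
  ... | inj₂ p = sym p

  ≢ends⇒¬inc : ∀ {z v d} → inc G z d ≡ true → v ≢ z → v ≢ other G z d → inc G v d ≡ false
  ≢ends⇒¬inc {z} {v} {d} h v≢z v≢o with inc G v d in iv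
  ... | false = refl
  ... | true with inc⇒≡⊎≡other h iv
  ... | inj₁ p = ⊥-elim (v≢z p)
  ... | inj₂ p = ⊥-elim (v≢o p)

  countFin-ends : ∀ d (q : Vtx G → Bool) →
    countFin (λ v → inc G v d ∧ q v) ≡ 𝟙 (q (end₁ G d)) + 𝟙 (q (end₂ G d))
  countFin-ends d q =
    trans (countFin-cong (λ v → ∧-distribʳ-∨ (q v) (end₁ G d ==F v) (end₂ G d ==F v)))
          (trans (countFin-∨ _ _ disjoint) (cong₂ _+_ (single (end₁ G d)) (single (end₂ G d))))
    where
    single : ∀ u → countFin (λ v → (u ==F v) ∧ q v) ≡ 𝟙 (q u)
    single u = trans (countFin-at u (λ v h → sym (==F⇒≡ (proj₁ (∧-true⁻ h)))))
                     (cong (λ b → 𝟙 (b ∧ q u)) (==F-refl u))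
    disjoint : ∀ v → ((end₁ G d ==F v) ∧ q v) ∧ ((end₂ G d ==F v) ∧ q v) ≡ false
    disjoint v with end₁ G d Fin.≟ v | end₂ G d Fin.≟ v
    ... | yes p | yes r = ⊥-elim (loopless G d (trans p (sym r)))
    ... | yes _ | no _ = ∧-zeroʳ (q v)
    ... | no _ | _ = refl

  countFin-endpoints : ∀ {z} d (q : Vtx G → Bool) → inc G z d ≡ true →
    countFin (λ v → inc G v d ∧ q v) ≡ 𝟙 (q z) + 𝟙 (q (other G z d))
  countFin-endpoints d q h with other-endpoints h
  ... | inj₁ (refl , q₂) rewrite q₂ = countFin-ends d q
  ... | inj₂ (refl , q₁) rewrite q₁ = trans (countFin-ends d q) (+-comm (𝟙 (q (end₁ G d))) _)

  sharedOne-at : ∀ {x a b} → inc G x a ≡ true → inc G x b ≡ true →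
    inc G (other G x a) b ≡ false → SharedOne G a b
  sharedOne-at {x} {a} {b} ha hb far =
    trans (countFin-endpoints a (λ v → inc G v b) ha) (cong₂ _+_ (cong 𝟙 hb) (cong 𝟙 far))

  sharedOne-sym : ∀ {a b} → SharedOne G a b → SharedOne G b a
  sharedOne-sym {a} {b} = trans (countFin-cong (λ v → ∧-comm (inc G v b) (inc G v a)))

  U-true⁺ : ∀ {φ : Coloring G} {z d c} → inc G z d ≡ true → φ d ≡ just c → U G φ z c ≡ true
  U-true⁺ {φ} {z} {d} {c} h e =
    anyFin-true⁺ {p = λ d → inc G z d ∧ (φ d ==M just c)} d (cong₂ _∧_ h (≡⇒==M-just e))

  U-true⁻ : ∀ {φ : Coloring G} {z c} → U G φ z c ≡ true → ∃ λ d → inc G z d ≡ true × φ d ≡ just c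
  U-true⁻ {φ} {z} h with anyFin-true⁻ h
  ... | d , r = d , proj₁ (∧-true⁻ r) , ==M-just⇒≡ (proj₂ (∧-true⁻ {inc G z d} r))

  U-false⁺ : ∀ {φ : Coloring G} {z c} → (∀ d → inc G z d ≡ true → φ d ≢ just c) → U G φ z c ≡ false
  U-false⁺ {φ} {z} {c} missing with U G φ z c in u
  ... | false = refl
  ... | true with U-true⁻ {φ} u
  ... | d , i , e = ⊥-elim (missing d i e)

  U-false⁻ : ∀ {φ : Coloring G} {z d c} → U G φ z c ≡ false → inc G z d ≡ true → φ d ≢ just c
  U-false⁻ {φ} u i e with () ← trans (sym (U-true⁺ {φ} i e)) u

module Availability (G : Multigraph) (L : ListAssignment G) where
  open Incidence G

  f⇒L : ∀ {z d c} → f G L z c ≡ true → inc G z d ≡ true → L d c ≡ true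
  f⇒L {z} {d} h i = subst (λ b → not b ∨ _ ≡ true) i (allFin-true⁻ h d)

  A-true⁻ : ∀ {φ z c} → A G L φ z c ≡ true → f G L z c ≡ true × U G φ z c ≡ false
  A-true⁻ {φ} {z} {c} h with f G L z c | U G φ z c
  ... | true | false = refl , refl

  A-true⁺ : ∀ {φ z c} → f G L z c ≡ true → U G φ z c ≡ false → A G L φ z c ≡ true
  A-true⁺ h u rewrite h | u = refl

  edgeHappy-at : ∀ {ψ d u v c} → ψ d ≡ nothing → Ends G d u v →
    A G L ψ v c ≡ true → U G ψ u c ≡ false → EdgeHappy G L ψ d
  edgeHappy-at {c = c} ψd (inj₁ (refl , refl)) Av Uu = ψd , inj₂ (c , Av , Uu)
  edgeHappy-at {c = c} ψd (inj₂ (refl , refl)) Av Uu = ψd , inj₁ (c , Av , Uu)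

  proper-injective : ∀ {φ z d d' c} → ProperPartial G L φ → inc G z d ≡ true → inc G z d' ≡ true →
    φ d ≡ just c → φ d' ≡ just c → d ≡ d'
  proper-injective {φ} {z} {d} {d'} {c} (_ , proper) i i' e e' with d Fin.≟ d'
  ... | yes p = p
  ... | no d≢d' = ⊥-elim (proper d d' c d≢d' (z , i , i') e e')

-- Shifts and fans

module Shifting (G : Multigraph) (φ : Coloring G) where
  open DecMembership (Fin._≟_ {nE G}) using (_∈?_)

  shift-∷-≢ : ∀ {e e' C d} → d ≢ e → Shift G φ (e ∷ e' ∷ C) d ≡ Shift G φ (e' ∷ C) d
  shift-∷-≢ {e} {d = d} d≢e rewrite ≢⇒==F-false d≢e = refl

  shift-∉ : ∀ {C d} → d ∉ C → Shift G φ C d ≡ φ d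
  shift-∉ {[]} _ = refl
  shift-∉ {e ∷ []} d∉ rewrite ≢⇒==F-false (λ d≡e → d∉ (here d≡e)) = refl
  shift-∉ {e ∷ e' ∷ C} d∉ =
    trans (shift-∷-≢ {C = C} (λ d≡e → d∉ (here d≡e))) (shift-∉ {e' ∷ C} (λ m → d∉ (there m)))

  shift-adjacent : ∀ {C a b} → Unique C → Adjacent C a b → Shift G φ C a ≡ φ b
  shift-adjacent {e ∷ _ ∷ _} _ ahere rewrite ==F-refl e = refl
  shift-adjacent {e ∷ e' ∷ C} u (athere h) =
    trans (shift-∷-≢ {C = C} (λ a≡e → unique-head u (subst (_∈ (e' ∷ C)) a≡e (adjacent-∈ˡ h))))
          (shift-adjacent (unique-tail u) h)

  shift-last : ∀ {C a} → Unique C → last C ≡ just a → Shift G φ C a ≡ nothing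
  shift-last {e ∷ []} _ refl rewrite ==F-refl e = refl
  shift-last {e ∷ e' ∷ C} u h =
    trans (shift-∷-≢ {C = C} (λ a≡e → unique-head u (subst (_∈ (e' ∷ C)) a≡e (last-∈ {C = e' ∷ C} h))))
          (shift-last (unique-tail u) h)

  shift-cases : ∀ {C} d → Unique C →
    (d ∉ C × Shift G φ C d ≡ φ d)
    ⊎ (∃ λ b → Adjacent C d b × Shift G φ C d ≡ φ b)
    ⊎ (last C ≡ just d × Shift G φ C d ≡ nothing)
  shift-cases {C} d u with d ∈? C
  ... | no d∉ = inj₁ (d∉ , shift-∉ d∉)
  ... | yes d∈ with ∈⇒adjacent⊎last d∈
  ... | inj₁ (b , h) = inj₂ (inj₁ (b , h , shift-adjacent u h))
  ... | inj₂ h = inj₂ (inj₂ (h , shift-last u h))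

  shift-sum-≥ : (w : Maybe ℕ → Edge G → ℕ) → ∀ a C → Unique (a ∷ C) →
    (∀ {a' b'} → Adjacent (a ∷ C) a' b' → w (φ b') b' ≤ w (φ b') a') →
    sum (map (λ d → w (φ d) d) C) ≤ sum (map (λ d → w (Shift G φ (a ∷ C) d) d) (a ∷ C))
  shift-sum-≥ w a [] _ _ = z≤n
  shift-sum-≥ w a (b ∷ C) u heavier = begin
    w (φ b) b + sum (map (λ d → w (φ d) d) C)
      ≤⟨ +-mono-≤ (heavier ahere) (shift-sum-≥ w b C (unique-tail u) (heavier ∘ athere)) ⟩
    w (φ b) a + sum (map (λ d → w (Shift G φ (b ∷ C) d) d) (b ∷ C))
      ≡⟨ cong₂ _+_ (cong (λ m → w m a) (sym (shift-adjacent u ahere)))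
                   (sum-map-cong (b ∷ C) (λ d∈ → cong (λ m → w m _) (sym (shift-∷-≢ {C = C} (≢head d∈))))) ⟩
    w (Shift G φ (a ∷ b ∷ C) a) a + sum (map (λ d → w (Shift G φ (a ∷ b ∷ C) d) d) (b ∷ C)) ∎
    where
    open ≤-Reasoning
    ≢head : ∀ {d} → d ∈ b ∷ C → d ≢ a
    ≢head d∈ d≡a = unique-head u (subst (_∈ b ∷ C) d≡a d∈)

endOf≡last : ∀ G (C : List (Edge G)) → endOf G C ≡ last C
endOf≡last G [] = refl
endOf≡last G (_ ∷ []) = refl
endOf≡last G (_ ∷ e' ∷ C) = endOf≡last G (e' ∷ C)

consecutive-from-adjacent : ∀ {G} C → (∀ {a b} → Adjacent C a b → SharedOne G a b) → Consecutive G C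
consecutive-from-adjacent [] _ = tt
consecutive-from-adjacent (_ ∷ []) _ = tt
consecutive-from-adjacent (_ ∷ b ∷ C) shared = shared ahere , consecutive-from-adjacent (b ∷ C) (shared ∘ athere)

module Fans (G : Multigraph) (L : ListAssignment G) (φ : Coloring G) (x : Vtx G)
            (φ-proper : ProperPartial G L φ) where
  open Incidence G
  open Availability G L
  open Shifting G φ

  record Fan (F : List (Edge G)) : Set where
    field
      unique    : Unique F
      at-x      : ∀ {d} → d ∈ F → inc G x d ≡ true
      available : ∀ {a b} → Adjacent F a b → ∃ λ c → φ b ≡ just c × A G L φ (other G x a) c ≡ true
  open Fan public

  fan-take : ∀ {F} n → Fan F → Fan (take n F)
  fan-take n fan = record
    { unique = take⁺ n (unique fan)
    ; at-x = at-x fan ∘ ∈-take⁻ n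
    ; available = available fan ∘ adjacent-take⁻ n }

  module _ {F : List (Edge G)} (fan : Fan F) where
    private ψ = Shift G φ F

    shift-origin : ∀ {d c} → ψ d ≡ just c →
      (d ∉ F × φ d ≡ just c)
      ⊎ (∃ λ b → Adjacent F d b × φ b ≡ just c × A G L φ (other G x d) c ≡ true)
    shift-origin {d} {c} ψd with shift-cases {F} d (unique fan)
    ... | inj₁ (d∉ , s) = inj₁ (d∉ , trans (sym s) ψd)
    ... | inj₂ (inj₂ (_ , s)) with () ← trans (sym s) ψd
    ... | inj₂ (inj₁ (b , h , s)) with available fan h
    ... | c' , φb , avail with refl ← just-injective (trans (sym φb) (trans (sym s) ψd)) =
      inj₂ (b , h , φb , avail)

    shift-proper : ProperPartial G L ψ
    shift-proper = in-lists , distinct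
      where
      in-lists : ∀ d c → ψ d ≡ just c → L d c ≡ true
      in-lists d c ψd with shift-origin ψd
      ... | inj₁ (_ , φd) = proj₁ φ-proper d c φd
      ... | inj₂ (b , h , _ , avail) = f⇒L (proj₁ (A-true⁻ {φ} avail)) (inc-other (at-x fan (adjacent-∈ˡ h)))
      kept-vs-moved : ∀ {d d' b c v} → d ∉ F → φ d ≡ just c → inc G v d ≡ true → inc G v d' ≡ true →
        Adjacent F d' b → φ b ≡ just c → A G L φ (other G x d') c ≡ true → ⊥
      kept-vs-moved {d} {d'} {b} {c} {v} d∉ φd vd vd' h φb avail
        with inc⇒≡⊎≡other (at-x fan (adjacent-∈ˡ h)) vd'
      ... | inj₁ refl = proj₂ φ-proper d b c (λ d≡b → d∉ (subst (_∈ F) (sym d≡b) (adjacent-∈ʳ h)))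
                          (v , vd , at-x fan (adjacent-∈ʳ h)) φd φb
      ... | inj₂ refl = U-false⁻ {φ} (proj₂ (A-true⁻ {φ} avail)) vd φd
      distinct : ∀ d d' c → d ≢ d' → (∃ λ v → inc G v d ≡ true × inc G v d' ≡ true) →
        ψ d ≡ just c → ψ d' ≡ just c → ⊥
      distinct d d' c d≢d' (v , vd , vd') ψd ψd' with shift-origin ψd | shift-origin ψd'
      ... | inj₁ (_ , φd) | inj₁ (_ , φd') = proj₂ φ-proper d d' c d≢d' (v , vd , vd') φd φd'
      ... | inj₁ (d∉ , φd) | inj₂ (b , h , φb , avail) = kept-vs-moved d∉ φd vd vd' h φb avail
      ... | inj₂ (b , h , φb , avail) | inj₁ (d∉ , φd) = kept-vs-moved d∉ φd vd' vd h φb avail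
      ... | inj₂ (b , h , φb , _) | inj₂ (b' , h' , φb' , _) with b Fin.≟ b'
      ... | yes refl = d≢d' (adjacent-injective (unique fan) h h')
      ... | no b≢b' = proj₂ φ-proper b b' c b≢b' (x , at-x fan (adjacent-∈ʳ h) , at-x fan (adjacent-∈ʳ h')) φb φb'

    fan-sharedOne : ∀ {a b} → Adjacent F a b → SharedOne G a b
    fan-sharedOne {a} {b} h with available fan h
    ... | c , φb , avail = sharedOne-at (at-x fan (adjacent-∈ˡ h)) (at-x fan (adjacent-∈ʳ h)) far
      where
      far : inc G (other G x a) b ≡ false
      far with inc G (other G x a) b in far-b
      ... | false = refl
      ... | true = ⊥-elim (U-false⁻ {φ} (proj₂ (A-true⁻ {φ} avail)) far-b φb)

    shift-U-at-x : ∀ {c} → U G ψ x c ≡ true → U G φ x c ≡ true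
    shift-U-at-x u with U-true⁻ {ψ} u
    ... | d , xd , ψd with shift-origin ψd
    ... | inj₁ (_ , φd) = U-true⁺ {φ} xd φd
    ... | inj₂ (b , h , φb , _) = U-true⁺ {φ} (at-x fan (adjacent-∈ʳ h)) φb

    shift-A-at-x : ∀ {c} → A G L φ x c ≡ true → A G L ψ x c ≡ true
    shift-A-at-x {c} a = A-true⁺ {ψ} (proj₁ (A-true⁻ {φ} a)) missing
      where
      missing : U G ψ x c ≡ false
      missing with U G ψ x c in u
      ... | false = refl
      ... | true with () ← trans (sym (shift-U-at-x u)) (proj₂ (A-true⁻ {φ} a))

    shift-off-x : ∀ {d} → inc G x d ≡ false → ψ d ≡ φ d
    shift-off-x x∉d = shift-∉ λ d∈ → contradiction (trans (sym (at-x fan d∈)) x∉d) λ ()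

  fan-shiftable : ∀ {e R} → Fan (e ∷ R) → φ e ≡ nothing → Shiftable G L φ (e ∷ R)
  fan-shiftable {e} {R} fan φe =
    (unique fan , consecutive-from-adjacent (e ∷ R) (fan-sharedOne fan)) , φe , shift-proper fan

-- The potential A(G,·)

module Potential (G : Multigraph) (L : ListAssignment G) (N : ℕ)
                 (f-bounded : ∀ x c → f G L x c ≡ true → c < N) where
  open Incidence G
  open Availability G L

  used : Coloring G → Vtx G → ℕ
  used φ z = cardBelow N (λ c → f G L z c ∧ U G φ z c)

  weight : Maybe ℕ → Edge G → ℕ
  weight m d = countFin (λ z → inc G z d ∧ maybe (f G L z) false m)

  Apot+used : ∀ φ → Apot G L N φ + sumFin (used φ) ≡ sumFin (λ z → cardBelow N (f G L z))
  Apot+used φ =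
    trans (sym (sumFin-+ (λ z → cardBelow N (A G L φ z)) (used φ)))
          (sumFin-cong λ z → trans (+-comm (cardBelow N (A G L φ z)) (used φ z))
                                    (countFin-split {N} (λ c → f G L z (toℕ c)) (λ c → U G φ z (toℕ c))))

  -- Each colour used at z is carried by exactly one edge at z.
  sum-used≡sum-weight : ∀ φ → ProperPartial G L φ → sumFin (used φ) ≡ sumFin (λ d → weight (φ d) d)
  sum-used≡sum-weight φ φ-proper = begin
    sumFin (used φ)
      ≡⟨ sumFin-cong (λ z → trans (cardBelow-colours N (f G L z) (f-bounded z) (λ d → inc G z d) φ
                                      (proper-injective {φ} φ-proper))
                                   (countFin≡sumFin (carries z))) ⟩
    sumFin (λ z → sumFin (λ d → 𝟙 (carries z d))) ≡⟨ sumFin-comm (λ z d → 𝟙 (carries z d)) ⟩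
    sumFin (λ d → sumFin (λ z → 𝟙 (carries z d))) ≡⟨ sumFin-cong (λ d → countFin≡sumFin (λ z → carries z d)) ⟨
    sumFin (λ d → weight (φ d) d)                  ∎
    where
    open ≡-Reasoning
    carries : Vtx G → Edge G → Bool
    carries z d = inc G z d ∧ maybe (f G L z) false (φ d)

  weight-nothing : ∀ d → weight nothing d ≡ 0
  weight-nothing d = countFin-∧-false (λ z → inc G z d)

  weight-≤-at : ∀ {x a b c} → inc G x a ≡ true → inc G x b ≡ true → f G L (other G x a) c ≡ true →
    weight (just c) b ≤ weight (just c) a
  weight-≤-at {x} {a} {b} {c} xa xb far
    rewrite countFin-endpoints a (λ z → f G L z c) xa | countFin-endpoints b (λ z → f G L z c) xb | far =
    +-monoʳ-≤ (𝟙 (f G L x c)) (𝟙≤1 (f G L (other G x b) c))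

  module _ (φ : Coloring G) (x : Vtx G) (φ-proper : ProperPartial G L φ) where
    open Shifting G φ
    open Fans G L φ x φ-proper

    Apot-shift-≤ : ∀ {e R} → Fan (e ∷ R) → φ e ≡ nothing → Apot G L N (Shift G φ (e ∷ R)) ≤ Apot G L N φ
    Apot-shift-≤ {e} {R} fan φe =
      cancel-≤ (trans (Apot+used ψ) (sym (Apot+used φ))) used-≤
      where
      F = e ∷ R
      ψ = Shift G φ F
      wφ wψ : Edge G → ℕ
      wφ d = weight (φ d) d
      wψ d = weight (ψ d) d
      heavier : ∀ {a b} → Adjacent F a b → weight (φ b) b ≤ weight (φ b) a
      heavier h with available fan h
      ... | c , φb , avail rewrite φb =
        weight-≤-at (at-x fan (adjacent-∈ˡ h)) (at-x fan (adjacent-∈ʳ h)) (proj₁ (A-true⁻ {φ} avail))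
      on-F : sum (map wφ F) ≤ sum (map wψ F)
      on-F rewrite φe | weight-nothing e = shift-sum-≥ weight e R (unique fan) heavier
      used-≤ : sumFin (used φ) ≤ sumFin (used ψ)
      used-≤ rewrite sum-used≡sum-weight φ φ-proper | sum-used≡sum-weight ψ (shift-proper fan) =
        cancel-≤ (sumFin-exchange-list F (unique fan) (λ d d∉ → cong (λ m → weight m d) (sym (shift-∉ d∉)))) on-F

-- Alternating paths

module Walks (G : Multigraph) (L : ListAssignment G) where
  open Incidence G
  open DecMembership (Fin._≟_ {nE G}) using (_∈?_)
  open DecMembership (Fin._≟_ {nV G}) using () renaming (_∈?_ to _∈ᵥ?_)

  canExtend? : ∀ ψ prev Es Vs cur c d → Dec (CanExtend G L ψ prev Es Vs cur c d)
  canExtend? ψ prev Es Vs cur c d =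
    (inc G cur d Bool.≟ true) ×-dec Maybe.≡-dec ℕ._≟_ (ψ d) (just c) ×-dec ¬? (d ∈? Es)
      ×-dec ¬? (other G cur d ∈ᵥ? Vs) ×-dec (countFin (λ v → inc G v prev ∧ inc G v d) ℕ.≟ 1)

  unused : List (Edge G) → ℕ
  unused Es = countFin (λ d → not (does (d ∈? Es)))

  unused-∷ : ∀ {d Es} → d ∉ Es → unused (d ∷ Es) < unused Es
  unused-∷ {d} {Es} d∉ =
    countFin-mono-< shrinks d (cong not (dec-true (d ∈? (d ∷ Es)) (here refl))) (cong not (dec-false (d ∈? Es) d∉))
    where
    shrinks : ∀ e → not (does (e ∈? (d ∷ Es))) ≡ true → not (does (e ∈? Es)) ≡ true
    shrinks e h = cong not (dec-false (e ∈? Es) λ e∈ →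
      contradiction (trans (sym h) (cong not (dec-true (e ∈? (d ∷ Es)) (there e∈)))) λ ())

  walk-exists : ∀ n ψ prev Es Vs cur c₁ c₂ → unused Es ≤ n → ∃ λ w → Walk G L ψ prev Es Vs cur c₁ c₂ w
  walk-exists n ψ prev Es Vs cur c₁ c₂ bound with Fin.any? (canExtend? ψ prev Es Vs cur c₁)
  ... | no stuck = cur , stop (λ d ext → stuck (d , ext))
  ... | yes (d , ext@(_ , _ , d∉Es , _)) with n | ≤-trans (unused-∷ d∉Es) bound
  ...   | zero | ()
  ...   | suc n | shrunk with walk-exists n ψ d (d ∷ Es) (other G cur d ∷ Vs) (other G cur d) c₂ c₁ (≤-pred shrunk)
  ...     | w , walk = w , step d ext walk

  -- A path of ψ ending at x is reversed into a path of ψ'. The reversed path can only be built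
  -- once its first edge is known, so along the forward path we carry the reversed remainder as a
  -- function of the context (previous edge, used edges and vertices) it will be placed in.
  module Reversal (ψ ψ' : Coloring G) (x v₀ : Vtx G) (α η : ℕ)
    (α-missing : U G ψ x α ≡ false)
    (agree-off-x : ∀ d → inc G x d ≡ false → ψ' d ≡ ψ d)
    (η-missing : ∀ d → inc G v₀ d ≡ true → ψ' d ≢ just η) where

    Alternating : ℕ → ℕ → Set
    Alternating c₁ c₂ = (c₁ ≡ α × c₂ ≡ η) ⊎ (c₁ ≡ η × c₂ ≡ α)

    Reversible : Edge G → List (Edge G) → List (Vtx G) → Vtx G → ℕ → ℕ → Set
    Reversible prev Es Vs cur c₁ c₂ = ∀ prev' Es' Vs' →
      (∀ {e} → e ∈ Es' → e ∉ Es) → (∀ {z} → z ∈ Vs' → z ∉ Vs) → SharedOne G prev' prev →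
      Walk G L ψ' prev' Es' Vs' cur c₂ c₁ v₀

    reversible-start : ∀ prev Es Vs → Reversible prev Es Vs v₀ α η
    reversible-start _ _ _ _ _ _ _ _ _ = stop (λ d ext → η-missing d (proj₁ ext) (proj₁ (proj₂ ext)))

    reverse : ∀ {prev Es Vs cur c₁ c₂ w} → Walk G L ψ prev Es (cur ∷ Vs) cur c₁ c₂ w → w ≡ x →
      cur ≢ x → cur ∉ Vs → Alternating c₁ c₂ → Reversible prev Es Vs cur c₁ c₂ →
      ∃ λ d → inc G x d ≡ true × ψ d ≡ just η × Walk G L ψ' d (d ∷ []) (other G x d ∷ []) (other G x d) α η v₀
    reverse (stop _) w≡x cur≢x _ _ _ = ⊥-elim (cur≢x w≡x)
    reverse {Es = Es} {Vs} {cur} {c₁} {c₂} (step d (cur∈d , ψd , d∉Es , next∉ , shared) rest) w≡x cur≢x cur∉ alt rev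
      with other G cur d Fin.≟ x
    ... | yes next≡x = arrive (ends-with-η alt ψd)
      where
      x∈d : inc G x d ≡ true
      x∈d = subst (λ v → inc G v d ≡ true) next≡x (inc-other cur∈d)
      ends-with-η : ∀ {a b} → Alternating a b → ψ d ≡ just a → a ≡ η × b ≡ α
      ends-with-η (inj₁ (refl , _)) ψd = ⊥-elim (U-false⁻ {ψ} α-missing x∈d ψd)
      ends-with-η (inj₂ p) _ = p
      back : other G x d ≡ cur
      back = trans (cong (λ v → other G v d) (sym next≡x)) (other-involutive cur∈d)
      arrive : c₁ ≡ η × c₂ ≡ α →
        ∃ λ d → inc G x d ≡ true × ψ d ≡ just η × Walk G L ψ' d (d ∷ []) (other G x d ∷ []) (other G x d) α η v₀
      arrive (refl , refl) = d , x∈d , ψd , subst (λ v → Walk G L ψ' d (d ∷ []) (v ∷ []) v α η v₀) (sym back)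
        (rev d (d ∷ []) (cur ∷ []) (λ { (here refl) → d∉Es }) (λ { (here refl) → cur∉ }) (sharedOne-sym shared))
    ... | no next≢x = reverse rest w≡x next≢x next∉ (swap alt) rev'
      where
      swap : ∀ {a b} → Alternating a b → Alternating b a
      swap (inj₁ (p , q)) = inj₂ (q , p)
      swap (inj₂ (p , q)) = inj₁ (q , p)
      ψ'd : ψ' d ≡ just c₁
      ψ'd = trans (agree-off-x d (≢ends⇒¬inc cur∈d (cur≢x ∘ sym) (next≢x ∘ sym))) ψd
      back : other G (other G cur d) d ≡ cur
      back = other-involutive cur∈d
      rev' : Reversible d (d ∷ Es) (cur ∷ Vs) (other G cur d) c₂ c₁
      rev' prev' Es' Vs' fresh-Es fresh-Vs shared' =
        step d (inc-other cur∈d , ψ'd , (λ d∈ → fresh-Es d∈ (here refl)) ,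
                subst (_∉ Vs') (sym back) (λ cur∈ → fresh-Vs cur∈ (here refl)) , shared')
          (subst (λ v → Walk G L ψ' d (d ∷ Es') (v ∷ Vs') v c₂ c₁ v₀) (sym back)
            (rev d (d ∷ Es') (cur ∷ Vs')
               (λ { (here refl) → d∉Es ; (there e∈) e∈Es → fresh-Es e∈ (there e∈Es) })
               (λ { (here refl) → cur∉ ; (there z∈) z∈Vs → fresh-Vs z∈ (there z∈Vs) })
               (sharedOne-sym shared)))

-- The procedure and its outcomes

module ProcedureRun (G : Multigraph) (L : ListAssignment G) (φ : Coloring G) (x : Vtx G)
                    (φ-proper : ProperPartial G L φ) (e : Edge G) where
  open Incidence G
  open Availability G L
  open Fans G L φ x φ-proper

  record Invariant (B : Vtx G → ℕ → Bool) (F : List (Edge G)) (yₖ : Vtx G) : Set where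
    field
      fan         : Fan F
      rest        : List (Edge G)
      starts-at-e : F ≡ e ∷ rest
      eₖ          : Edge G
      last-eₖ     : last F ≡ just eₖ
      yₖ-far      : yₖ ≡ other G x eₖ
      B-available : ∀ {z c} → B z c ≡ true → A G L φ z c ≡ true
      B-unshifted : ∀ {z c a b} → B z c ≡ true → Adjacent F a b → other G x a ≡ z → φ b ≢ just c
  open Invariant public

  record Halted (F : List (Edge G)) (j : ℕ) : Set where
    field
      {B}     : Vtx G → ℕ → Bool
      yₖ      : Vtx G
      η       : ℕ
      inv     : Invariant B F yₖ
      η∈B     : B yₖ η ≡ true
      exit    : (U G φ x η ≡ false × j ≡ length F)
              ⊎ (∃ λ d → inc G x d ≡ true × φ d ≡ just η ×
                   ∃ λ (i : Fin (length F)) → lookup F i ≡ d × j ≡ toℕ i)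

  invariant-init : inc G x e ≡ true → Invariant (A G L φ) (e ∷ []) (other G x e)
  invariant-init x∈e = record
    { fan = record { unique = [] ∷ [] ; at-x = λ { (here refl) → x∈e } ; available = λ { (athere ()) } }
    ; rest = [] ; starts-at-e = refl ; eₖ = e ; last-eₖ = refl ; yₖ-far = refl
    ; B-available = λ h → h ; B-unshifted = λ _ → λ { (athere ()) } }

  invariant-step : ∀ {B F yₖ η d} → Invariant B F yₖ → B yₖ η ≡ true →
    inc G x d ≡ true → φ d ≡ just η → d ∉ F →
    Invariant (removeB G L B yₖ η) (F ++ d ∷ []) (other G x d)
  invariant-step {B} {F} {yₖ} {η} {d} I η∈B x∈d φd d∉F = record
    { fan = record
      { unique = ++⁺ (unique (fan I)) ([] ∷ []) λ { (d∈F , here refl) → d∉F d∈F }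
      ; at-x = λ d'∈ → [ at-x (fan I) , (λ { (here refl) → x∈d }) ]′ (∈-++⁻ F d'∈)
      ; available = available' }
    ; rest = rest I ++ d ∷ [] ; starts-at-e = cong (_++ d ∷ []) (starts-at-e I)
    ; eₖ = d ; last-eₖ = last-∷ʳ F d ; yₖ-far = refl
    ; B-available = λ {z} {c} h → B-available I (kept z c h)
    ; B-unshifted = unshifted }
    where
    yₖ-ends-eₖ : ∀ {a} → last F ≡ just a → other G x a ≡ yₖ
    yₖ-ends-eₖ la with refl ← trans (sym la) (last-eₖ I) = sym (yₖ-far I)
    kept : ∀ z c → removeB G L B yₖ η z c ≡ true → B z c ≡ true
    kept z c h with (z ==F yₖ) ∧ (c ≡ᵇ η)
    ... | false = h
    available' : ∀ {a b} → Adjacent (F ++ d ∷ []) a b → ∃ λ c → φ b ≡ just c × A G L φ (other G x a) c ≡ true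
    available' h with adjacent-∷ʳ⁻ {C = F} h
    ... | inj₁ h' = available (fan I) h'
    ... | inj₂ (la , refl) = η , φd , subst (λ z → A G L φ z η ≡ true) (sym (yₖ-ends-eₖ la)) (B-available I η∈B)
    unshifted : ∀ {z c a b} → removeB G L B yₖ η z c ≡ true → Adjacent (F ++ d ∷ []) a b →
      other G x a ≡ z → φ b ≢ just c
    unshifted {z} {c} h adj far with (z ==F yₖ) ∧ (c ≡ᵇ η) in removed | adjacent-∷ʳ⁻ {C = F} adj
    ... | false | inj₁ adj' = B-unshifted I h adj' far
    ... | false | inj₂ (la , refl) = λ φb →
      removed-η (trans (sym (cong₂ (λ z c → (z ==F yₖ) ∧ (c ≡ᵇ η))
                                  (trans (sym far) (yₖ-ends-eₖ la)) (just-injective (trans (sym φb) φd))))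
                       removed)
      where
      removed-η : (yₖ ==F yₖ) ∧ (η ≡ᵇ η) ≢ false
      removed-η h rewrite ==F-refl yₖ | ≡ᵇ-refl η with () ← h

  run : ∀ {B F₀ yₖ F β j} → Invariant B F₀ yₖ → Proc G L φ x B F₀ yₖ F β j → Halted F j
  run I (outNew η (η∈B , _) fresh) = record
    { yₖ = _ ; η = η ; inv = I ; η∈B = η∈B ; exit = inj₁ (fresh , refl) }
  run I (outRep η (η∈B , _) _ d x∈d φd i Fᵢ≡d) = record
    { yₖ = _ ; η = η ; inv = I ; η∈B = η∈B ; exit = inj₂ (d , x∈d , φd , i , Fᵢ≡d , refl) }
  run I (cont η (η∈B , _) _ d x∈d φd d∉F rest) = run (invariant-step I η∈B x∈d φd d∉F) rest

module Outcomes (G : Multigraph) (L : ListAssignment G) (N : ℕ)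
            (f-bounded : ∀ x c → f G L x c ≡ true → c < N)
            (deg-bound : ∀ x → deg G x + μ G x ≤ cardBelow N (f G L x))
            (φ : Coloring G) (φ-proper : ProperPartial G L φ)
            (e : Edge G) (φe : φ e ≡ nothing) (x : Vtx G) (x∈e : inc G x e ≡ true) where
  open Incidence G
  open Availability G L
  open Shifting G φ
  open Fans G L φ x φ-proper
  open Potential G L N f-bounded
  open ProcedureRun G L φ x φ-proper e
  open Walks G L

  Outcome : List (Edge G) → ℕ → Set
  Outcome F j = HappyChain G L φ F
    ⊎ (Content G L N φ F ⊎ Content G L N φ (take j F))
    ⊎ AltOutcome G L N φ F
    ⊎ AltOutcome G L N φ (take j F)

  -- The uncoloured edge e makes fewer colours used at x than deg x ≤ |f(x,L)|.
  missing-at-x : ∃ λ α → A G L φ x α ≡ true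
  missing-at-x with countFin-pos⇒∃ {N} {λ c → A G L φ x (toℕ c)} positive
    where
    used<deg : used φ x < deg G x
    used<deg = subst (_< deg G x)
      (sym (cardBelow-colours N (f G L x) (f-bounded x) (λ d → inc G x d) φ (proper-injective {φ} φ-proper)))
      (countFin-mono-< (λ d → proj₁ ∘ ∧-true⁻) e
        (trans (cong (λ m → inc G x e ∧ maybe (f G L x) false m) φe) (∧-zeroʳ _)) x∈e)
    positive : 0 < cardBelow N (A G L φ x)
    positive = +-cancelˡ-< (used φ x) 0 _ (begin-strict
      used φ x + 0             ≡⟨ +-identityʳ _ ⟩
      used φ x                 <⟨ used<deg ⟩
      deg G x                  ≤⟨ m≤m+n (deg G x) (μ G x) ⟩
      deg G x + μ G x          ≤⟨ deg-bound x ⟩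
      cardBelow N (f G L x)    ≡⟨ countFin-split {N} (λ c → f G L x (toℕ c)) (λ c → U G φ x (toℕ c)) ⟨
      used φ x + cardBelow N (A G L φ x) ∎)
      where open ≤-Reasoning
  ... | c , α∈A = toℕ c , α∈A

  content-or-same : ∀ {e' R} → Fan (e' ∷ R) → φ e' ≡ nothing →
    Content G L N φ (e' ∷ R) ⊎ Apot G L N φ ≡ Apot G L N (Shift G φ (e' ∷ R))
  content-or-same fan φe' with m≤n⇒m<n∨m≡n (Apot-shift-≤ φ x φ-proper fan φe')
  ... | inj₁ smaller = inj₁ (fan-shiftable fan φe' , inj₁ smaller)
  ... | inj₂ same = inj₂ (sym same)

  module AtHalt {R : List (Edge G)} {j : ℕ} (halted : Halted (e ∷ R) j) where
    F = e ∷ R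
    I = Halted.inv halted
    fanF = fan I
    ψ = Shift G φ F
    y = Halted.yₖ halted
    η = Halted.η halted
    ek = eₖ I

    ek-at-x : inc G x ek ≡ true
    ek-at-x = at-x fanF (last-∈ (last-eₖ I))

    y≢x : y ≢ x
    y≢x y≡x = other-≢ ek-at-x (trans (sym (yₖ-far I)) y≡x)

    ek-ends : Ends G ek x y
    ek-ends = subst (Ends G ek x) (sym (yₖ-far I)) (ends-other ek-at-x)

    ψ-ek : ψ ek ≡ nothing
    ψ-ek = shift-last (unique fanF) (last-eₖ I)

    η-available-at-y : A G L φ y η ≡ true
    η-available-at-y = B-available I (Halted.η∈B halted)

    η-unused-at-y : ∀ {C} (fanC : Fan C) → (∀ {a b} → Adjacent C a b → Adjacent F a b) →
      U G (Shift G φ C) y η ≡ false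
    η-unused-at-y {C} fanC ⊆F = U-false⁺ {Shift G φ C} λ d y∈d ψd → case d y∈d (shift-origin fanC ψd)
      where
      case : ∀ d → inc G y d ≡ true → _ → ⊥
      case d y∈d (inj₁ (_ , φd)) = U-false⁻ {φ} (proj₂ (A-true⁻ {φ} η-available-at-y)) y∈d φd
      case d y∈d (inj₂ (b , adj , φb , _)) with inc⇒≡⊎≡other (at-x fanC (adjacent-∈ˡ adj)) y∈d
      ... | inj₁ y≡x = y≢x y≡x
      ... | inj₂ y≡far = B-unshifted I (Halted.η∈B halted) (⊆F adj) (sym y≡far) φb

    η-available-after : A G L ψ y η ≡ true
    η-available-after = A-true⁺ {ψ} (proj₁ (A-true⁻ {φ} η-available-at-y)) (η-unused-at-y fanF (λ h → h))

    happy-if-fresh : U G φ x η ≡ false → HappyChain G L φ F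
    happy-if-fresh fresh =
      fan-shiftable fanF φe , ek , trans (endOf≡last G F) (last-eₖ I) ,
      edgeHappy-at {ψ} ψ-ek ek-ends η-available-after fresh-after
      where
      fresh-after : U G ψ x η ≡ false
      fresh-after with U G ψ x η in u
      ... | false = refl
      ... | true with () ← trans (sym (shift-U-at-x fanF u)) fresh

    module Repeat {d : Edge G} (x∈d : inc G x d ≡ true) (φd : φ d ≡ just η)
                  (i : Fin (length R)) (Fᵢ≡d : lookup R i ≡ d) where
      n = suc (toℕ i)
      F' = take n F
      ψ' = Shift G φ F'
      fanF' = fan-take n fanF
      α = proj₁ missing-at-x
      α∈A = proj₂ missing-at-x

      predecessor : ∃ λ a → Adjacent F a d
      predecessor = ∈-tail⇒predecessor (subst (_∈ R) Fᵢ≡d (∈-lookup i))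
      a = proj₁ predecessor
      a→d = proj₂ predecessor

      a-at-x : inc G x a ≡ true
      a-at-x = at-x fanF (adjacent-∈ˡ a→d)

      last-F' : last F' ≡ just a
      last-F' = last-take-lookup (fs i) (unique fanF) a→d Fᵢ≡d

      ψ'-a : ψ' a ≡ nothing
      ψ'-a = shift-last (unique fanF') last-F'

      ψ-a : ψ a ≡ just η
      ψ-a = trans (shift-adjacent (unique fanF) a→d) φd

      η-available-at-far-a : A G L ψ' (other G x a) η ≡ true
      η-available-at-far-a with available fanF a→d
      ... | c , φd' , avail with refl ← just-injective (trans (sym φd') φd) =
        A-true⁺ {ψ'} (proj₁ (A-true⁻ {φ} avail))
          (U-false⁺ {ψ'} λ d'' far∈d'' ψ'd'' → case far∈d'' (shift-origin fanF' ψ'd''))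
        where
        case : ∀ {d''} → inc G (other G x a) d'' ≡ true → _ → ⊥
        case far∈d'' (inj₁ (_ , φd'')) = U-false⁻ {φ} (proj₂ (A-true⁻ {φ} avail)) far∈d'' φd''
        case {d''} _ (inj₂ (b , adj , φb , _))
          with refl ← proper-injective {φ} φ-proper (at-x fanF (adjacent-∈ʳ (adjacent-take⁻ n adj))) x∈d φb φd
          with refl ← adjacent-injective (unique fanF) (adjacent-take⁻ n adj) a→d =
          last-¬adjacent (unique fanF') last-F' adj

      module Rev = Reversal ψ ψ' x y α η (proj₂ (A-true⁻ {ψ} (shift-A-at-x fanF α∈A)))
        (λ d'' x∉d'' → trans (shift-off-x fanF' x∉d'') (sym (shift-off-x fanF x∉d'')))
        (λ d'' y∈d'' → U-false⁻ {ψ'} (η-unused-at-y fanF' (adjacent-take⁻ n)) y∈d'')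

      outcome-via-prefix : ∀ {w} → Walk G L ψ ek (ek ∷ []) (y ∷ []) y α η w → w ≡ x → Outcome F n
      outcome-via-prefix walk w≡x
        with Rev.reverse walk w≡x y≢x (λ ()) (inj₁ (refl , refl)) (Rev.reversible-start ek (ek ∷ []) [])
      ... | d' , x∈d' , ψd' , walk'
        with refl ← proper-injective {ψ} (shift-proper fanF) x∈d' a-at-x ψd' ψ-a
        with content-or-same fanF' φe
      ... | inj₁ content = inj₂ (inj₁ (inj₂ content))
      ... | inj₂ same = inj₂ (inj₂ (inj₂ (same , a , x , other G x a , α , η , ψ'-a , ends-other a-at-x ,
                          shift-A-at-x fanF' α∈A , η-available-at-far-a , y , walk' , y≢x ∘ sym)))

      repeat-outcome : Outcome F n
      repeat-outcome with content-or-same fanF φe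
      ... | inj₁ content = inj₂ (inj₁ (inj₁ content))
      ... | inj₂ same with walk-exists _ ψ ek (ek ∷ []) (y ∷ []) y α η ≤-refl
      ... | w , walk with w Fin.≟ x
      ... | yes w≡x = outcome-via-prefix walk w≡x
      ... | no w≢x = inj₂ (inj₂ (inj₁ (same , ek , x , y , α , η , ψ-ek , ek-ends ,
                       shift-A-at-x fanF α∈A , η-available-after , w , walk , w≢x ∘ sym)))

  outcome-on-halting : ∀ {R j} → Halted (e ∷ R) j → Outcome (e ∷ R) j
  outcome-on-halting halted with Halted.exit halted
  ... | inj₁ (fresh , refl) = inj₁ (AtHalt.happy-if-fresh halted fresh)
  ... | inj₂ (d , x∈d , φd , fz , e≡d , refl) with () ← trans (sym φe) (trans (cong φ e≡d) φd)
  ... | inj₂ (d , x∈d , φd , fs i , Fᵢ≡d , refl) = AtHalt.Repeat.repeat-outcome halted x∈d φd i Fᵢ≡d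

lemma4p1 : (G : Multigraph) (L : ListAssignment G) (N : ℕ) →
    (∀ x c → f G L x c ≡ true → c < N) →
    (∀ x → deg G x + μ G x ≤ cardBelow N (f G L x)) →
    (φ : Coloring G) → ProperPartial G L φ →
    (e : Edge G) → φ e ≡ nothing → (x : Vtx G) → inc G x e ≡ true →
    (F : List (Edge G)) (β j : ℕ) → Procedure G L φ e x F β j →
    HappyChain G L φ F
    ⊎ (Content G L N φ F ⊎ Content G L N φ (take j F))
    ⊎ AltOutcome G L N φ F
    ⊎ AltOutcome G L N φ (take j F)
lemma4p1 G L N f-bounded deg-bound φ φ-proper e φe x x∈e F β j proc =
  subst (λ F → Outcome F j) (sym F≡e∷R) (outcome-on-halting (subst (λ F → Halted F j) F≡e∷R halted))
  where
  open Outcomes G L N f-bounded deg-bound φ φ-proper e φe x x∈e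
  open ProcedureRun G L φ x φ-proper e
  halted = run (invariant-init x∈e) proc
  F≡e∷R = starts-at-e (Halted.inv halted)
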